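{- Let $k\in\mathbb{N}=\{1,2,\dots\}$, $r\in\mathbb{N}_0=\{0,1,2,\dots\}$ and $p\in\mathbb{N}$ with $p\ge r+2$. Then \[ S(k,r+1;p)=\frac{1}{r!}\sum_{l=1}^{r+1}\left[\begin{array}{c} r+1\\ l\end{array}\right]\sum_{\substack{i+j=k\\ i,j\ge 0}}(-1)^i\,\zeta_r^\star(\{1\}_i)\,U_{j,r}(p+1-l). \]
   Context: For a positive integer $n$ and nonnegative integers $s_1,\dots,s_m$, the multiple harmonic numbers and multiple harmonic star numbers are $\zeta_n(s_1,\dots,s_m)=\sum_{n\ge n_1>n_2>\cdots>n_m\ge 1}\frac{1}{n_1^{s_1}\cdots n_m^{s_m}}$ and $\zeta_n^\star(s_1,\dots,s_m)=\sum_{n\ge n_1\ge n_2\ge\cdots\ge n_m\ge 1}\frac{1}{n_1^{s_1}\cdots n_m^{s_m}}$, with $\zeta_n(\emptyset)=\zeta_n^\star(\emptyset)=1$, $\zeta_n(s_1,\dots,s_m)=0$ if $n<m$; for $n=0$ one sets $\zeta_0(\emptyset)=\zeta_0^\star(\emptyset)=1$ and $\zeta_0(\{1\}_j)=\zeta_0^\star(\{1\}_i)=0$ for $i,j\ge1$. The notation $\{a\}_q$ means $a$ repeated $q$ times. For positive integers $m,k,n$ the generalized hyperharmonic numbers are \[h_n^{(m)}(k)=\sum_{\substack{1\le n_{m+k-1}<\cdots<n_{m+1}<n_m\\ \le n_{m-1}\le\cdots\le n_1\le n}}\frac{1}{n_m n_{m+1}\cdots n_{m+k-1}}\] (for $k=1$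 the condition is just $1\le n_m\le n_{m-1}\le\cdots\le n_1\le n$), and $S(k,m;p)=\sum_{n=1}^\infty \frac{h_n^{(m)}(k)}{n^p}$. For integers $j\ge 0$, $r\ge 0$ and $q\ge 2$, $U_{j,r}(q)=\sum_{n=1}^\infty\frac{\zeta_{n+r}(\{1\}_j)}{n^q}$. The unsigned Stirling numbers of the first kind $\left[\begin{array}{c} n\\ k\end{array}\right]$ are defined by $n!\,x(1+x)(1+\frac{x}{2})\cdots(1+\frac{x}{n})=\sum_{k=0}^n\left[\begin{array}{c} n+1\\ k+1\end{array}\right]x^{k+1}$, with $\left[\begin{array}{c} n\\ k\end{array}\right]=0$ for $n<k$, $\left[\begin{array}{c} n\\ 0\end{array}\right]=\left[\begin{array}{c} 0\\ k\end{array}\right]=0$ for $n,k\ge1$, and $\left[\begin{array}{c} 0\\ 0\end{array}\right]=1$. -}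

module Defs where

open import Data.Nat as ℕ using (ℕ; zero; suc; _^_; _!)
open import Data.Nat.Properties using (m^n≢0; _!≢0)
open import Data.Integer using (+_)
open import Data.List using (List; []; _∷_; replicate)
open import Data.Rational using (ℚ; 0ℚ; 1ℚ; _+_; _*_; _-_; -_; _/_)

sumFrom1 : ℕ → (ℕ → ℚ) → ℚ
sumFrom1 zero    f = 0ℚ
sumFrom1 (suc n) f = sumFrom1 n f + f (suc n)

invPow : ℕ → ℕ → ℚ
invPow a s = _/_ (+ 1) (suc a ^ s) {{m^n≢0 (suc a) s}}

-- 1 / a^s, with the value 0 at a = 0 (never used there)
inv^ : ℕ → ℕ → ℚ
inv^ zero    s = 0ℚ
inv^ (suc a) s = invPow a s

-- multiple harmonic number ζ_n(s₁,…,s_m) = Σ_{n ≥ n₁ > n₂ > … > n_m ≥ 1} Π n_i^{-s_i}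
-- (recursion on the first index: ζ_n(s∷ss) = Σ_{a=1}^n a^{-s} ζ_{a-1}(ss))
ζ : ℕ → List ℕ → ℚ
ζ n []       = 1ℚ
ζ n (s ∷ ss) = sumFrom1 n (λ a → inv^ a s * ζ (ℕ.pred a) ss)

-- multiple harmonic star number ζ*_n(s₁,…,s_m) = Σ_{n ≥ n₁ ≥ … ≥ n_m ≥ 1} Π n_i^{-s_i}
ζ⋆ : ℕ → List ℕ → ℚ
ζ⋆ n []       = 1ℚ
ζ⋆ n (s ∷ ss) = sumFrom1 n (λ a → inv^ a s * ζ⋆ a ss)

ones : ℕ → List ℕ
ones q = replicate q 1

-- weak chain part: W j t = Σ_{t ≥ a₁ ≥ … ≥ a_j ≥ 1} (strict part at a_j)
-- strict part at t: Σ_{t ≥ n_m > n_{m+1} > … > n_{m+k-1} ≥ 1} 1/(n_m⋯n_{m+k-1}) = ζ_t({1}_k)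
hyperW : ℕ → ℕ → ℕ → ℚ
hyperW k zero    t = ζ t (ones k)
hyperW k (suc j) t = sumFrom1 t (λ a → hyperW k j a)

-- generalized hyperharmonic number h_n^{(m)}(k), m ≥ 1 given as suc m'
-- (chain n ≥ n₁ ≥ … ≥ n_{m-1} ≥ n_m > … > n_{m+k-1} ≥ 1)
h : ℕ → ℕ → ℕ → ℚ
h n m k = hyperW k (ℕ.pred m) n

-- partial sum Σ_{n=1}^{N} h_n^{(m)}(k) / n^p of S(k,m;p)
Spartial : ℕ → ℕ → ℕ → ℕ → ℚ
Spartial k m p N = sumFrom1 N (λ n → h n m k * inv^ n p)

-- partial sum Σ_{n=1}^{N} ζ_{n+r}({1}_j) / n^q of U_{j,r}(q)
Upartial : ℕ → ℕ → ℕ → ℕ → ℚ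
Upartial j r q N = sumFrom1 N (λ n → ζ (n ℕ.+ r) (ones j) * inv^ n q)

-- unsigned Stirling numbers of the first kind, via the coefficients of
-- x(x+1)⋯(x+n-1) = Σ_k [n k] x^k : [n+1, k+1] = n [n, k+1] + [n, k]
stirling1 : ℕ → ℕ → ℕ
stirling1 zero    zero    = 1
stirling1 zero    (suc k) = 0
stirling1 (suc n) zero    = 0
stirling1 (suc n) (suc k) = n ℕ.* stirling1 n (suc k) ℕ.+ stirling1 n k

ℕtoℚ : ℕ → ℚ
ℕtoℚ n = + n / 1

sgn : ℕ → ℚ
sgn zero    = 1ℚ
sgn (suc i) = - sgn i

sumFrom0 : ℕ → (ℕ → ℚ) → ℚ
sumFrom0 zero    f = f 0
sumFrom0 (suc n) f = sumFrom0 n f + f (suc n)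

-- right-hand side with each U_{j,r}(q) replaced by its N-th partial sum
RHSpartial : ℕ → ℕ → ℕ → ℕ → ℚ
RHSpartial k r p N =
  _/_ (+ 1) (r !) {{r !≢0}} *
  sumFrom1 (suc r) (λ l → ℕtoℚ (stirling1 (suc r) l) *
    sumFrom0 k (λ i → sgn i * ζ⋆ r (ones i) * Upartial (k ℕ.∸ i) r (p ℕ.+ 1 ℕ.∸ l) N))

{-# OPTIONS --safe #-}
-- The identity already holds between the N-th partial sums, summand by summand, so N₀ = 0 works
-- (r ≤ p suffices for that; p ≥ r + 2 is only needed for the series to converge).
-- Put E_m(x) = ∏_{a=1}^{m} (1 + x/a). The generating functions of ζ_m({1}_j) and (-1)^i ζ⋆_r({1}_i)
-- are E_m(x) and E_r(x)⁻¹, so the inner sum over i + j = k is [x^k] E_{n+r}(x)/E_r(x).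
-- From h_n^{(r+2)}(k) = h_{n-1}^{(r+2)}(k) + h_n^{(r+1)}(k), induction on r and n together with
-- Pascal's rule for the rising factorial gives, for k ≥ 1,
--   r! h_n^{(r+1)}(k) = (n+1)(n+2)⋯(n+r) · [x^k] E_{n+r}(x)/E_r(x),
-- and (n+1)⋯(n+r) = Σ_l [r+1, l] n^{l-1} turns n^{-p} into the powers n^{-(p+1-l)}.
module Submission where

open import Defs
open import Level using (0ℓ)
open import Function using (_∘_)
open import Data.Product using (∃; _,_)
open import Data.Nat as ℕ using (ℕ; zero; suc; _≥_; _!; _^_; _∸_)
import Data.Nat.Properties as ℕₚ
open import Data.Nat.Properties using (m^n≢0; _!≢0)
import Data.Nat.Tactic.RingSolver as ℕ-Solver
import Data.Integer as ℤ
import Data.Integer.Properties as ℤₚ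
import Data.Integer.Tactic.RingSolver as ℤ-Solver
open import Data.Rational using (ℚ; 0ℚ; 1ℚ; _+_; _*_; -_; _-_; _/_; _<_; ∣_∣; toℚᵘ)
open import Data.Rational.Properties
  using ( toℚᵘ-injective; toℚᵘ-fromℚᵘ; toℚᵘ-homo-+; toℚᵘ-homo-*; _≟_; +-*-commutativeRing; +-0-group; +-0-commutativeMonoid
        ; *-identityˡ; *-identityʳ; *-zeroˡ; *-zeroʳ; +-identityˡ; +-identityʳ; +-inverseʳ
        ; *-distribˡ-+; *-distribʳ-+; +-assoc; *-assoc; *-comm)
open import Data.Rational.Unnormalised as ℚᵘ using (mkℚᵘ; *≡*) renaming (_≃_ to _≃ᵘ_)
import Data.Rational.Unnormalised.Properties as ℚᵘₚ
open import Algebra.Bundles using (CommutativeMonoid)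
open import Algebra.Properties.Group +-0-group using (identityˡ-unique)
open import Algebra.Properties.CommutativeSemigroup (CommutativeMonoid.commutativeSemigroup +-0-commutativeMonoid)
  using () renaming (interchange to +-interchange)
open import Relation.Nullary.Decidable using (dec⇒maybe)
open import Relation.Binary.PropositionalEquality
open import Tactic.RingSolver using (solve-∀)
open import Tactic.RingSolver.Core.AlmostCommutativeRing using (AlmostCommutativeRing; fromCommutativeRing)

ℚ-ring : AlmostCommutativeRing 0ℓ 0ℓ
ℚ-ring = fromCommutativeRing +-*-commutativeRing (λ x → dec⇒maybe (0ℚ ≟ x))

toℚᵘ-ℕtoℚ : ∀ n → toℚᵘ (ℕtoℚ n) ≃ᵘ mkℚᵘ (ℤ.+ n) 0
toℚᵘ-ℕtoℚ n = toℚᵘ-fromℚᵘ (mkℚᵘ (ℤ.+ n) 0)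

ℕtoℚ-homo-+ : ∀ m n → ℕtoℚ (m ℕ.+ n) ≡ ℕtoℚ m + ℕtoℚ n
ℕtoℚ-homo-+ m n = toℚᵘ-injective (begin
  toℚᵘ (ℕtoℚ (m ℕ.+ n))                ≈⟨ toℚᵘ-ℕtoℚ (m ℕ.+ n) ⟩
  mkℚᵘ (ℤ.+ (m ℕ.+ n)) 0                ≈⟨ *≡* (trans (cong (ℤ._* ℤ.+ 1) (ℤₚ.pos-+ m n)) (+-over-1 (ℤ.+ m) (ℤ.+ n))) ⟩
  mkℚᵘ (ℤ.+ m) 0 ℚᵘ.+ mkℚᵘ (ℤ.+ n) 0    ≈⟨ ℚᵘₚ.+-cong (toℚᵘ-ℕtoℚ m) (toℚᵘ-ℕtoℚ n) ⟨
  toℚᵘ (ℕtoℚ m) ℚᵘ.+ toℚᵘ (ℕtoℚ n)      ≈⟨ toℚᵘ-homo-+ (ℕtoℚ m) (ℕtoℚ n) ⟨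
  toℚᵘ (ℕtoℚ m + ℕtoℚ n)                ∎)
  where
  open ℚᵘₚ.≃-Reasoning
  +-over-1 : ∀ x y → (x ℤ.+ y) ℤ.* ℤ.+ 1 ≡ (x ℤ.* ℤ.+ 1 ℤ.+ y ℤ.* ℤ.+ 1) ℤ.* ℤ.+ 1
  +-over-1 = ℤ-Solver.solve-∀

ℕtoℚ-homo-* : ∀ m n → ℕtoℚ (m ℕ.* n) ≡ ℕtoℚ m * ℕtoℚ n
ℕtoℚ-homo-* m n = toℚᵘ-injective (begin
  toℚᵘ (ℕtoℚ (m ℕ.* n))                ≈⟨ toℚᵘ-ℕtoℚ (m ℕ.* n) ⟩
  mkℚᵘ (ℤ.+ (m ℕ.* n)) 0                ≈⟨ *≡* (cong (ℤ._* ℤ.+ 1) (ℤₚ.pos-* m n)) ⟩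
  mkℚᵘ (ℤ.+ m) 0 ℚᵘ.* mkℚᵘ (ℤ.+ n) 0    ≈⟨ ℚᵘₚ.*-cong (toℚᵘ-ℕtoℚ m) (toℚᵘ-ℕtoℚ n) ⟨
  toℚᵘ (ℕtoℚ m) ℚᵘ.* toℚᵘ (ℕtoℚ n)      ≈⟨ toℚᵘ-homo-* (ℕtoℚ m) (ℕtoℚ n) ⟨
  toℚᵘ (ℕtoℚ m * ℕtoℚ n)                ∎)
  where open ℚᵘₚ.≃-Reasoning

1/n*n≡1 : ∀ n .{{_ : ℕ.NonZero n}} → (ℤ.+ 1 / n) * ℕtoℚ n ≡ 1ℚ
1/n*n≡1 (suc d) = toℚᵘ-injective (begin
  toℚᵘ ((ℤ.+ 1 / suc d) * ℕtoℚ (suc d))          ≈⟨ toℚᵘ-homo-* (ℤ.+ 1 / suc d) (ℕtoℚ (suc d)) ⟩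
  toℚᵘ (ℤ.+ 1 / suc d) ℚᵘ.* toℚᵘ (ℕtoℚ (suc d))  ≈⟨ ℚᵘₚ.*-cong (toℚᵘ-fromℚᵘ (mkℚᵘ (ℤ.+ 1) d)) (toℚᵘ-ℕtoℚ (suc d)) ⟩
  mkℚᵘ (ℤ.+ 1) d ℚᵘ.* mkℚᵘ (ℤ.+ suc d) 0        ≈⟨ *≡* (trans (1*x*1 (ℤ.+ suc d)) (cong (λ e → ℤ.+ 1 ℤ.* ℤ.+ e) (sym (ℕₚ.*-identityʳ (suc d))))) ⟩
  toℚᵘ 1ℚ                                        ∎)
  where
  open ℚᵘₚ.≃-Reasoning
  1*x*1 : ∀ x → (ℤ.+ 1 ℤ.* x) ℤ.* ℤ.+ 1 ≡ ℤ.+ 1 ℤ.* x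
  1*x*1 = ℤ-Solver.solve-∀

inv^-inverseˡ : ∀ a s → inv^ (suc a) s * ℕtoℚ (suc a ^ s) ≡ 1ℚ
inv^-inverseˡ a s = 1/n*n≡1 (suc a ^ s) {{m^n≢0 (suc a) s}}

inv^1-inverseʳ : ∀ a → ℕtoℚ (suc a) * inv^ (suc a) 1 ≡ 1ℚ
inv^1-inverseʳ a = begin
  ℕtoℚ (suc a) * inv^ (suc a) 1      ≡⟨ *-comm (ℕtoℚ (suc a)) (inv^ (suc a) 1) ⟩
  inv^ (suc a) 1 * ℕtoℚ (suc a)      ≡⟨ cong (λ e → inv^ (suc a) 1 * ℕtoℚ e) (ℕₚ.^-identityʳ (suc a)) ⟨
  inv^ (suc a) 1 * ℕtoℚ (suc a ^ 1)  ≡⟨ inv^-inverseˡ a 1 ⟩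
  1ℚ                                 ∎
  where open ≡-Reasoning

*-inv^1-cancelʳ : ∀ x a → ℕtoℚ (x ℕ.* suc a) * inv^ (suc a) 1 ≡ ℕtoℚ x
*-inv^1-cancelʳ x a = begin
  ℕtoℚ (x ℕ.* suc a) * inv^ (suc a) 1          ≡⟨ cong (_* inv^ (suc a) 1) (ℕtoℚ-homo-* x (suc a)) ⟩
  ℕtoℚ x * ℕtoℚ (suc a) * inv^ (suc a) 1       ≡⟨ *-assoc (ℕtoℚ x) (ℕtoℚ (suc a)) (inv^ (suc a) 1) ⟩
  ℕtoℚ x * (ℕtoℚ (suc a) * inv^ (suc a) 1)     ≡⟨ cong (ℕtoℚ x *_) (inv^1-inverseʳ a) ⟩
  ℕtoℚ x * 1ℚ                                  ≡⟨ *-identityʳ (ℕtoℚ x) ⟩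
  ℕtoℚ x                                       ∎
  where open ≡-Reasoning

inv^-∸ : ∀ a {l p} → l ℕ.≤ p → inv^ (suc a) (p ∸ l) ≡ ℕtoℚ (suc a ^ l) * inv^ (suc a) p
inv^-∸ a {l} {p} l≤p = begin
  inv^ A (p ∸ l)                                          ≡⟨ *-identityʳ (inv^ A (p ∸ l)) ⟨
  inv^ A (p ∸ l) * 1ℚ                                     ≡⟨ cong (inv^ A (p ∸ l) *_) (inv^-inverseˡ a p) ⟨
  inv^ A (p ∸ l) * (inv^ A p * ℕtoℚ (A ^ p))              ≡⟨ cong (λ e → inv^ A (p ∸ l) * (inv^ A p * ℕtoℚ e)) A^p≡ ⟩
  inv^ A (p ∸ l) * (inv^ A p * ℕtoℚ (A ^ (p ∸ l) ℕ.* A ^ l))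
    ≡⟨ cong (λ e → inv^ A (p ∸ l) * (inv^ A p * e)) (ℕtoℚ-homo-* (A ^ (p ∸ l)) (A ^ l)) ⟩
  inv^ A (p ∸ l) * (inv^ A p * (ℕtoℚ (A ^ (p ∸ l)) * ℕtoℚ (A ^ l)))
    ≡⟨ regroup (inv^ A (p ∸ l)) (inv^ A p) (ℕtoℚ (A ^ (p ∸ l))) (ℕtoℚ (A ^ l)) ⟩
  inv^ A (p ∸ l) * ℕtoℚ (A ^ (p ∸ l)) * (ℕtoℚ (A ^ l) * inv^ A p)
    ≡⟨ cong (_* (ℕtoℚ (A ^ l) * inv^ A p)) (inv^-inverseˡ a (p ∸ l)) ⟩
  1ℚ * (ℕtoℚ (A ^ l) * inv^ A p)                         ≡⟨ *-identityˡ (ℕtoℚ (A ^ l) * inv^ A p) ⟩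
  ℕtoℚ (A ^ l) * inv^ A p                                ∎
  where
  open ≡-Reasoning
  A = suc a
  A^p≡ : A ^ p ≡ A ^ (p ∸ l) ℕ.* A ^ l
  A^p≡ = trans (cong (A ^_) (sym (ℕₚ.m∸n+n≡m l≤p))) (ℕₚ.^-distribˡ-+-* A (p ∸ l) l)
  regroup : ∀ x y u v → x * (y * (u * v)) ≡ x * u * (v * y)
  regroup = solve-∀ ℚ-ring

sumFrom1-cong : ∀ M {f g : ℕ → ℚ} → (∀ l → l ℕ.< M → f (suc l) ≡ g (suc l)) → sumFrom1 M f ≡ sumFrom1 M g
sumFrom1-cong zero    f≡g = refl
sumFrom1-cong (suc M) f≡g =
  cong₂ _+_ (sumFrom1-cong M (λ l l<M → f≡g l (ℕₚ.m<n⇒m<1+n l<M))) (f≡g M (ℕₚ.n<1+n M))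

sumFrom1-zero : ∀ M → sumFrom1 M (λ _ → 0ℚ) ≡ 0ℚ
sumFrom1-zero zero    = refl
sumFrom1-zero (suc M) = trans (+-identityʳ (sumFrom1 M (λ _ → 0ℚ))) (sumFrom1-zero M)

sumFrom1-+ : ∀ M (f g : ℕ → ℚ) → sumFrom1 M (λ l → f l + g l) ≡ sumFrom1 M f + sumFrom1 M g
sumFrom1-+ zero    f g = sym (+-identityʳ 0ℚ)
sumFrom1-+ (suc M) f g = trans (cong (_+ (f (suc M) + g (suc M))) (sumFrom1-+ M f g))
                               (+-interchange (sumFrom1 M f) (sumFrom1 M g) (f (suc M)) (g (suc M)))

sumFrom1-homo : (φ : ℚ → ℚ) → φ 0ℚ ≡ 0ℚ → (∀ x y → φ (x + y) ≡ φ x + φ y) →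
                ∀ M f → φ (sumFrom1 M f) ≡ sumFrom1 M (φ ∘ f)
sumFrom1-homo φ φ0 φ+ zero    f = φ0
sumFrom1-homo φ φ0 φ+ (suc M) f = trans (φ+ _ _) (cong (_+ φ (f (suc M))) (sumFrom1-homo φ φ0 φ+ M f))

sumFrom1-*ˡ : ∀ M x (f : ℕ → ℚ) → x * sumFrom1 M f ≡ sumFrom1 M (λ l → x * f l)
sumFrom1-*ˡ M x = sumFrom1-homo (x *_) (*-zeroʳ x) (*-distribˡ-+ x) M

sumFrom1-*ʳ : ∀ M x (f : ℕ → ℚ) → sumFrom1 M f * x ≡ sumFrom1 M (λ l → f l * x)
sumFrom1-*ʳ M x = sumFrom1-homo (_* x) (*-zeroˡ x) (λ y z → *-distribʳ-+ x y z) M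

sumFrom1-interchange : ∀ {X : Set} (S : (X → ℚ) → ℚ) → S (λ _ → 0ℚ) ≡ 0ℚ →
                       (∀ f g → S (λ x → f x + g x) ≡ S f + S g) →
                       ∀ M (f : X → ℕ → ℚ) → S (λ x → sumFrom1 M (f x)) ≡ sumFrom1 M (λ l → S (λ x → f x l))
sumFrom1-interchange S S0 S+ zero    f = S0
sumFrom1-interchange S S0 S+ (suc M) f =
  trans (S+ _ _) (cong (_+ S (λ x → f x (suc M))) (sumFrom1-interchange S S0 S+ M f))

sumFrom1-shift : ∀ M (f : ℕ → ℚ) → sumFrom1 (suc M) f ≡ f 1 + sumFrom1 M (f ∘ suc)
sumFrom1-shift zero    f = trans (+-identityˡ (f 1)) (sym (+-identityʳ (f 1)))
sumFrom1-shift (suc M) f = trans (cong (_+ f (suc (suc M))) (sumFrom1-shift M f)) (+-assoc (f 1) _ _)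

sumFrom0-cong : ∀ K {f g : ℕ → ℚ} → (∀ i → f i ≡ g i) → sumFrom0 K f ≡ sumFrom0 K g
sumFrom0-cong zero    f≡g = f≡g 0
sumFrom0-cong (suc K) f≡g = cong₂ _+_ (sumFrom0-cong K f≡g) (f≡g (suc K))

sumFrom0-zero : ∀ K → sumFrom0 K (λ _ → 0ℚ) ≡ 0ℚ
sumFrom0-zero zero    = refl
sumFrom0-zero (suc K) = trans (+-identityʳ (sumFrom0 K (λ _ → 0ℚ))) (sumFrom0-zero K)

sumFrom0-+ : ∀ K (f g : ℕ → ℚ) → sumFrom0 K (λ i → f i + g i) ≡ sumFrom0 K f + sumFrom0 K g
sumFrom0-+ zero    f g = refl
sumFrom0-+ (suc K) f g = trans (cong (_+ (f (suc K) + g (suc K))) (sumFrom0-+ K f g))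
                               (+-interchange (sumFrom0 K f) (sumFrom0 K g) (f (suc K)) (g (suc K)))

sumFrom0-*ʳ : ∀ K x (f : ℕ → ℚ) → sumFrom0 K f * x ≡ sumFrom0 K (λ i → f i * x)
sumFrom0-*ʳ zero    x f = refl
sumFrom0-*ʳ (suc K) x f = trans (*-distribʳ-+ x (sumFrom0 K f) (f (suc K)))
                                (cong (_+ f (suc K) * x) (sumFrom0-*ʳ K x f))

sumFrom0-shift : ∀ K (f : ℕ → ℚ) → sumFrom0 (suc K) f ≡ f 0 + sumFrom0 K (f ∘ suc)
sumFrom0-shift zero    f = refl
sumFrom0-shift (suc K) f = trans (cong (_+ f (suc (suc K))) (sumFrom0-shift K f)) (+-assoc (f 0) _ _)

Seq : Set
Seq = ℕ → ℚ

δ : Seq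
δ zero    = 1ℚ
δ (suc _) = 0ℚ

_⊛_ : Seq → Seq → Seq
(a ⊛ b) zero    = a 0 * b 0
(a ⊛ b) (suc k) = a 0 * b (suc k) + ((a ∘ suc) ⊛ b) k

⟨1+_x⟩_ : ℚ → Seq → Seq
(⟨1+ c x⟩ a) zero    = a 0
(⟨1+ c x⟩ a) (suc k) = a (suc k) + c * a k

⊛-cong : ∀ {a a′ b b′} → a ≗ a′ → b ≗ b′ → ∀ k → (a ⊛ b) k ≡ (a′ ⊛ b′) k
⊛-cong a≗a′ b≗b′ zero    = cong₂ _*_ (a≗a′ 0) (b≗b′ 0)
⊛-cong a≗a′ b≗b′ (suc k) = cong₂ _+_ (cong₂ _*_ (a≗a′ 0) (b≗b′ (suc k))) (⊛-cong (a≗a′ ∘ suc) b≗b′ k)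

⊛-zeroˡ : ∀ b k → ((λ _ → 0ℚ) ⊛ b) k ≡ 0ℚ
⊛-zeroˡ b zero    = *-zeroˡ (b 0)
⊛-zeroˡ b (suc k) = trans (cong₂ _+_ (*-zeroˡ (b (suc k))) (⊛-zeroˡ b k)) (+-identityˡ 0ℚ)

⊛-identityˡ : ∀ b k → (δ ⊛ b) k ≡ b k
⊛-identityˡ b zero    = *-identityˡ (b 0)
⊛-identityˡ b (suc k) = trans (cong₂ _+_ (*-identityˡ (b (suc k))) (⊛-zeroˡ b k)) (+-identityʳ (b (suc k)))

⊛-linearˡ : ∀ c a a′ b k → ((λ i → a i + c * a′ i) ⊛ b) k ≡ (a ⊛ b) k + c * (a′ ⊛ b) k
⊛-linearˡ c a a′ b zero    = linear (a 0) (a′ 0) (b 0) c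
  where
  linear : ∀ x y z c → (x + c * y) * z ≡ x * z + c * (y * z)
  linear = solve-∀ ℚ-ring
⊛-linearˡ c a a′ b (suc k) =
  trans (cong ((a 0 + c * a′ 0) * b (suc k) +_) (⊛-linearˡ c (a ∘ suc) (a′ ∘ suc) b k))
        (linear (a 0) (a′ 0) (b (suc k)) c (((a ∘ suc) ⊛ b) k) (((a′ ∘ suc) ⊛ b) k))
  where
  linear : ∀ x y z c u v → (x + c * y) * z + (u + c * v) ≡ x * z + u + c * (y * z + v)
  linear = solve-∀ ℚ-ring

⊛-⟨1+x⟩ˡ : ∀ c a b k → ((⟨1+ c x⟩ a) ⊛ b) k ≡ (⟨1+ c x⟩ (a ⊛ b)) k
⊛-⟨1+x⟩ˡ c a b zero    = refl
⊛-⟨1+x⟩ˡ c a b (suc k) =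
  trans (cong (a 0 * b (suc k) +_) (⊛-linearˡ c (a ∘ suc) a b k))
        (sym (+-assoc (a 0 * b (suc k)) (((a ∘ suc) ⊛ b) k) (c * (a ⊛ b) k)))

⊛-⟨1+x⟩ʳ : ∀ c a b k → (a ⊛ (⟨1+ c x⟩ b)) k ≡ (⟨1+ c x⟩ (a ⊛ b)) k
⊛-⟨1+x⟩ʳ c a b zero          = refl
⊛-⟨1+x⟩ʳ c a b (suc zero)    = base (a 0) (b 1) (b 0) c (a 1)
  where
  base : ∀ x y z c w → x * (y + c * z) + w * z ≡ x * y + w * z + c * (x * z)
  base = solve-∀ ℚ-ring
⊛-⟨1+x⟩ʳ c a b (suc (suc k)) =
  trans (cong (a 0 * (b (suc (suc k)) + c * b (suc k)) +_) (⊛-⟨1+x⟩ʳ c (a ∘ suc) b (suc k)))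
        (step (a 0) (b (suc (suc k))) (b (suc k)) c (((a ∘ suc) ⊛ b) (suc k)) (((a ∘ suc) ⊛ b) k))
  where
  step : ∀ x y z c u v → x * (y + c * z) + (u + c * v) ≡ x * y + u + c * (x * z + v)
  step = solve-∀ ℚ-ring

⊛-sum : ∀ k a b → (a ⊛ b) k ≡ sumFrom0 k (λ i → a i * b (k ∸ i))
⊛-sum zero    a b = refl
⊛-sum (suc k) a b = trans (cong (a 0 * b (suc k) +_) (⊛-sum k (a ∘ suc) b))
                          (sym (sumFrom0-shift k (λ i → a i * b (suc k ∸ i))))

sumFrom0-⊛ : ∀ K N (a : Seq) (b : ℕ → Seq) (w : ℕ → ℚ) →
  sumFrom0 K (λ i → a i * sumFrom1 N (λ n → b n (K ∸ i) * w n)) ≡ sumFrom1 N (λ n → (a ⊛ b n) K * w n)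
sumFrom0-⊛ K N a b w = begin
  sumFrom0 K (λ i → a i * sumFrom1 N (λ n → b n (K ∸ i) * w n))
    ≡⟨ sumFrom0-cong K (λ i → sumFrom1-*ˡ N (a i) (λ n → b n (K ∸ i) * w n)) ⟩
  sumFrom0 K (λ i → sumFrom1 N (λ n → a i * (b n (K ∸ i) * w n)))
    ≡⟨ sumFrom1-interchange (sumFrom0 K) (sumFrom0-zero K) (sumFrom0-+ K) N (λ i n → a i * (b n (K ∸ i) * w n)) ⟩
  sumFrom1 N (λ n → sumFrom0 K (λ i → a i * (b n (K ∸ i) * w n)))
    ≡⟨ sumFrom1-cong N (λ n _ → factor (suc n)) ⟩
  sumFrom1 N (λ n → (a ⊛ b n) K * w n)
    ∎
  where
  open ≡-Reasoning
  factor : ∀ n → sumFrom0 K (λ i → a i * (b n (K ∸ i) * w n)) ≡ (a ⊛ b n) K * w n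
  factor n = begin
    sumFrom0 K (λ i → a i * (b n (K ∸ i) * w n))  ≡⟨ sumFrom0-cong K (λ i → *-assoc (a i) (b n (K ∸ i)) (w n)) ⟨
    sumFrom0 K (λ i → a i * b n (K ∸ i) * w n)    ≡⟨ sumFrom0-*ʳ K (w n) (λ i → a i * b n (K ∸ i)) ⟨
    sumFrom0 K (λ i → a i * b n (K ∸ i)) * w n    ≡⟨ cong (_* w n) (⊛-sum K a (b n)) ⟨
    (a ⊛ b n) K * w n                             ∎

-- ζ₁ m and ζ⋆₁± r are the coefficients of E_m(x) and E_r(x)⁻¹, so Π r m gives those of E_m(x)/E_r(x).
ζ₁ : ℕ → Seq
ζ₁ m j = ζ m (ones j)

ζ⋆₁± : ℕ → Seq
ζ⋆₁± r i = sgn i * ζ⋆ r (ones i)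

ζ₁-zero : ζ₁ 0 ≗ δ
ζ₁-zero zero    = refl
ζ₁-zero (suc j) = refl

ζ₁-suc : ∀ m → ζ₁ (suc m) ≗ ⟨1+ inv^ (suc m) 1 x⟩ ζ₁ m
ζ₁-suc m zero    = refl
ζ₁-suc m (suc j) = refl

ζ⋆₁±-zero : ζ⋆₁± 0 ≗ δ
ζ⋆₁±-zero zero    = refl
ζ⋆₁±-zero (suc i) = *-zeroʳ (sgn (suc i))

ζ⋆₁±-suc : ∀ r → ζ⋆₁± r ≗ ⟨1+ inv^ (suc r) 1 x⟩ ζ⋆₁± (suc r)
ζ⋆₁±-suc r zero    = refl
ζ⋆₁±-suc r (suc i) = step (sgn i) (ζ⋆ r (ones (suc i))) (inv^ (suc r) 1) (ζ⋆ (suc r) (ones i))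
  where
  step : ∀ s z c w → (- s) * z ≡ (- s) * (z + c * w) + c * (s * w)
  step = solve-∀ ℚ-ring

Π : ℕ → ℕ → Seq
Π r m = ζ⋆₁± r ⊛ ζ₁ m

Π-zero : ∀ m k → Π 0 m k ≡ ζ₁ m k
Π-zero m k = trans (⊛-cong ζ⋆₁±-zero (λ _ → refl) k) (⊛-identityˡ (ζ₁ m) k)

Π-sucˡ : ∀ r m k → Π r m k ≡ (⟨1+ inv^ (suc r) 1 x⟩ Π (suc r) m) k
Π-sucˡ r m k = trans (⊛-cong (ζ⋆₁±-suc r) (λ _ → refl) k) (⊛-⟨1+x⟩ˡ (inv^ (suc r) 1) (ζ⋆₁± (suc r)) (ζ₁ m) k)

Π-sucʳ : ∀ r m k → Π r (suc m) k ≡ (⟨1+ inv^ (suc m) 1 x⟩ Π r m) k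
Π-sucʳ r m k = trans (⊛-cong (λ _ → refl) (ζ₁-suc m) k) (⊛-⟨1+x⟩ʳ (inv^ (suc m) 1) (ζ⋆₁± r) (ζ₁ m) k)

Π-diagonal : ∀ r k → Π r r k ≡ δ k
Π-diagonal zero    k       = trans (Π-zero 0 k) (ζ₁-zero k)
Π-diagonal (suc r) zero    = refl
Π-diagonal (suc r) (suc k) = identityˡ-unique (Π (suc r) (suc r) (suc k)) (c * δ k) (begin
  Π (suc r) (suc r) (suc k) + c * δ k                    ≡⟨ cong (λ e → Π (suc r) (suc r) (suc k) + c * e) (Π-diagonal (suc r) k) ⟨
  Π (suc r) (suc r) (suc k) + c * Π (suc r) (suc r) k    ≡⟨ Π-sucˡ r (suc r) (suc k) ⟨
  Π r (suc r) (suc k)                                    ≡⟨ Π-sucʳ r r (suc k) ⟩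
  Π r r (suc k) + c * Π r r k                            ≡⟨ cong₂ (λ u v → u + c * v) (Π-diagonal r (suc k)) (Π-diagonal r k) ⟩
  0ℚ + c * δ k                                           ≡⟨ +-identityˡ (c * δ k) ⟩
  c * δ k                                                ∎)
  where
  open ≡-Reasoning
  c = inv^ (suc r) 1

_↑_ : ℕ → ℕ → ℕ
x ↑ zero  = 1
x ↑ suc r = x ↑ r ℕ.* (x ℕ.+ r)

↑-sucˡ : ∀ x r → x ↑ suc r ≡ x ℕ.* (suc x ↑ r)
↑-sucˡ x zero    = base x
  where
  base : ∀ x → 1 ℕ.* (x ℕ.+ 0) ≡ x ℕ.* 1
  base = ℕ-Solver.solve-∀
↑-sucˡ x (suc r) = trans (cong (ℕ._* (x ℕ.+ suc r)) (↑-sucˡ x r)) (step x (suc x ↑ r) r)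
  where
  step : ∀ x y r → x ℕ.* y ℕ.* (x ℕ.+ suc r) ≡ x ℕ.* (y ℕ.* (suc x ℕ.+ r))
  step = ℕ-Solver.solve-∀

↑-pascal : ∀ x r → x ↑ suc r ℕ.+ suc r ℕ.* (suc x ↑ r) ≡ suc x ↑ suc r
↑-pascal x r = trans (cong (ℕ._+ suc r ℕ.* (suc x ↑ r)) (↑-sucˡ x r)) (collect x r (suc x ↑ r))
  where
  collect : ∀ x r y → x ℕ.* y ℕ.+ suc r ℕ.* y ≡ y ℕ.* (suc x ℕ.+ r)
  collect = ℕ-Solver.solve-∀

stirling1-above-diagonal : ∀ {m l} → m ℕ.< l → stirling1 m l ≡ 0
stirling1-above-diagonal {zero}  {suc l} _           = refl
stirling1-above-diagonal {suc m} {suc l} (ℕ.s≤s m<l) = begin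
  m ℕ.* stirling1 m (suc l) ℕ.+ stirling1 m l
    ≡⟨ cong₂ (λ u v → m ℕ.* u ℕ.+ v) (stirling1-above-diagonal (ℕₚ.m<n⇒m<1+n m<l)) (stirling1-above-diagonal m<l) ⟩
  m ℕ.* 0 ℕ.+ 0  ≡⟨ trans (ℕₚ.+-identityʳ (m ℕ.* 0)) (ℕₚ.*-zeroʳ m) ⟩
  0              ∎
  where open ≡-Reasoning

stirlingTerm : ℕ → ℕ → ℕ → ℚ
stirlingTerm m n l = ℕtoℚ (stirling1 m l) * ℕtoℚ (n ^ (l ∸ 1))

stirlingSum : ℕ → ℕ → ℚ
stirlingSum m n = sumFrom1 m (stirlingTerm m n)

stirlingSum-extend : ∀ m n → sumFrom1 (suc m) (stirlingTerm m n) ≡ stirlingSum m n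
stirlingSum-extend m n = begin
  stirlingSum m n + ℕtoℚ (stirling1 m (suc m)) * ℕtoℚ (n ^ m)
    ≡⟨ cong (λ e → stirlingSum m n + ℕtoℚ e * ℕtoℚ (n ^ m)) (stirling1-above-diagonal (ℕₚ.n<1+n m)) ⟩
  stirlingSum m n + 0ℚ * ℕtoℚ (n ^ m)  ≡⟨ cong (stirlingSum m n +_) (*-zeroˡ (ℕtoℚ (n ^ m))) ⟩
  stirlingSum m n + 0ℚ                 ≡⟨ +-identityʳ (stirlingSum m n) ⟩
  stirlingSum m n                      ∎
  where open ≡-Reasoning

stirlingSum-shift : ∀ m n →
  sumFrom1 (suc (suc m)) (λ l → ℕtoℚ (stirling1 (suc m) (l ∸ 1)) * ℕtoℚ (n ^ (l ∸ 1))) ≡ ℕtoℚ n * stirlingSum (suc m) n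
stirlingSum-shift m n = begin
  sumFrom1 (suc (suc m)) u                           ≡⟨ sumFrom1-shift (suc m) u ⟩
  u 1 + sumFrom1 (suc m) (u ∘ suc)                   ≡⟨ +-identityˡ (sumFrom1 (suc m) (u ∘ suc)) ⟩
  sumFrom1 (suc m) (u ∘ suc)                         ≡⟨ sumFrom1-cong (suc m) (λ l _ → power-suc l) ⟩
  sumFrom1 (suc m) (λ l → ℕtoℚ n * stirlingTerm (suc m) n l)
    ≡⟨ sumFrom1-*ˡ (suc m) (ℕtoℚ n) (stirlingTerm (suc m) n) ⟨
  ℕtoℚ n * stirlingSum (suc m) n                     ∎
  where
  open ≡-Reasoning
  u : ℕ → ℚ
  u l = ℕtoℚ (stirling1 (suc m) (l ∸ 1)) * ℕtoℚ (n ^ (l ∸ 1))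
  power-suc : ∀ l → u (suc (suc l)) ≡ ℕtoℚ n * stirlingTerm (suc m) n (suc l)
  power-suc l = trans (cong (ℕtoℚ (stirling1 (suc m) (suc l)) *_) (ℕtoℚ-homo-* n (n ^ l)))
                      (swap (ℕtoℚ (stirling1 (suc m) (suc l))) (ℕtoℚ n) (ℕtoℚ (n ^ l)))
    where
    swap : ∀ x y z → x * (y * z) ≡ y * (x * z)
    swap = solve-∀ ℚ-ring

stirlingSum-suc : ∀ m n → stirlingSum (suc (suc m)) n ≡ (ℕtoℚ (suc m) + ℕtoℚ n) * stirlingSum (suc m) n
stirlingSum-suc m n = begin
  sumFrom1 (suc m′) (stirlingTerm (suc m′) n)
    ≡⟨ sumFrom1-cong (suc m′) (λ l _ → recurrence l) ⟩
  sumFrom1 (suc m′) (λ l → ℕtoℚ m′ * stirlingTerm m′ n l + u l)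
    ≡⟨ sumFrom1-+ (suc m′) (λ l → ℕtoℚ m′ * stirlingTerm m′ n l) u ⟩
  sumFrom1 (suc m′) (λ l → ℕtoℚ m′ * stirlingTerm m′ n l) + sumFrom1 (suc m′) u
    ≡⟨ cong (_+ sumFrom1 (suc m′) u) (sumFrom1-*ˡ (suc m′) (ℕtoℚ m′) (stirlingTerm m′ n)) ⟨
  ℕtoℚ m′ * sumFrom1 (suc m′) (stirlingTerm m′ n) + sumFrom1 (suc m′) u
    ≡⟨ cong₂ (λ v w → ℕtoℚ m′ * v + w) (stirlingSum-extend m′ n) (stirlingSum-shift m n) ⟩
  ℕtoℚ m′ * stirlingSum m′ n + ℕtoℚ n * stirlingSum m′ n
    ≡⟨ *-distribʳ-+ (stirlingSum m′ n) (ℕtoℚ m′) (ℕtoℚ n) ⟨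
  (ℕtoℚ m′ + ℕtoℚ n) * stirlingSum m′ n
    ∎
  where
  open ≡-Reasoning
  m′ = suc m
  u : ℕ → ℚ
  u l = ℕtoℚ (stirling1 m′ (l ∸ 1)) * ℕtoℚ (n ^ (l ∸ 1))
  recurrence : ∀ l → stirlingTerm (suc m′) n (suc l) ≡ ℕtoℚ m′ * stirlingTerm m′ n (suc l) + u (suc l)
  recurrence l = begin
    ℕtoℚ (m′ ℕ.* stirling1 m′ (suc l) ℕ.+ stirling1 m′ l) * ℕtoℚ (n ^ l)
      ≡⟨ cong (_* ℕtoℚ (n ^ l)) (trans (ℕtoℚ-homo-+ (m′ ℕ.* stirling1 m′ (suc l)) (stirling1 m′ l))
                                          (cong (_+ ℕtoℚ (stirling1 m′ l)) (ℕtoℚ-homo-* m′ (stirling1 m′ (suc l))))) ⟩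
    (ℕtoℚ m′ * ℕtoℚ (stirling1 m′ (suc l)) + ℕtoℚ (stirling1 m′ l)) * ℕtoℚ (n ^ l)
      ≡⟨ distrib (ℕtoℚ m′) (ℕtoℚ (stirling1 m′ (suc l))) (ℕtoℚ (stirling1 m′ l)) (ℕtoℚ (n ^ l)) ⟩
    ℕtoℚ m′ * stirlingTerm m′ n (suc l) + u (suc l)
      ∎
    where
    distrib : ∀ x y z w → (x * y + z) * w ≡ x * (y * w) + z * w
    distrib = solve-∀ ℚ-ring

stirlingSum≡↑ : ∀ m n → stirlingSum (suc m) n ≡ ℕtoℚ (suc n ↑ m)
stirlingSum≡↑ zero    n = refl
stirlingSum≡↑ (suc m) n = begin
  stirlingSum (suc (suc m)) n                      ≡⟨ stirlingSum-suc m n ⟩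
  (ℕtoℚ (suc m) + ℕtoℚ n) * stirlingSum (suc m) n  ≡⟨ cong₂ _*_ (sym (ℕtoℚ-homo-+ (suc m) n)) (stirlingSum≡↑ m n) ⟩
  ℕtoℚ (suc m ℕ.+ n) * ℕtoℚ (suc n ↑ m)            ≡⟨ *-comm (ℕtoℚ (suc m ℕ.+ n)) (ℕtoℚ (suc n ↑ m)) ⟩
  ℕtoℚ (suc n ↑ m) * ℕtoℚ (suc m ℕ.+ n)            ≡⟨ cong (λ e → ℕtoℚ (suc n ↑ m) * ℕtoℚ (suc e)) (ℕₚ.+-comm m n) ⟩
  ℕtoℚ (suc n ↑ m) * ℕtoℚ (suc n ℕ.+ m)            ≡⟨ ℕtoℚ-homo-* (suc n ↑ m) (suc n ℕ.+ m) ⟨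
  ℕtoℚ (suc n ↑ suc m)                             ∎
  where open ≡-Reasoning

pascal-combination : ∀ P Q P′ s c d x₁ x₀ → P + s * Q ≡ P′ → s * c ≡ 1ℚ → P′ * d ≡ Q →
                     P * x₁ + s * (Q * (x₁ + c * x₀)) ≡ P′ * (x₁ + d * x₀)
pascal-combination P Q P′ s c d x₁ x₀ P+sQ≡P′ sc≡1 P′d≡Q = begin
  P * x₁ + s * (Q * (x₁ + c * x₀))        ≡⟨ expand P Q s c x₁ x₀ ⟩
  (P + s * Q) * x₁ + s * c * (Q * x₀)     ≡⟨ cong₂ (λ u v → u * x₁ + v * (Q * x₀)) P+sQ≡P′ sc≡1 ⟩
  P′ * x₁ + 1ℚ * (Q * x₀)                 ≡⟨ cong (λ e → P′ * x₁ + 1ℚ * (e * x₀)) P′d≡Q ⟨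
  P′ * x₁ + 1ℚ * (P′ * d * x₀)            ≡⟨ collect P′ d x₁ x₀ ⟩
  P′ * (x₁ + d * x₀)                      ∎
  where
  open ≡-Reasoning
  expand : ∀ P Q s c x₁ x₀ → P * x₁ + s * (Q * (x₁ + c * x₀)) ≡ (P + s * Q) * x₁ + s * c * (Q * x₀)
  expand = solve-∀ ℚ-ring
  collect : ∀ P′ d x₁ x₀ → P′ * x₁ + 1ℚ * (P′ * d * x₀) ≡ P′ * (x₁ + d * x₀)
  collect = solve-∀ ℚ-ring

hyperW-closedForm : ∀ k r n → ℕtoℚ (r !) * hyperW (suc k) r n ≡ ℕtoℚ (suc n ↑ r) * Π r (n ℕ.+ r) (suc k)
hyperW-closedForm k zero    n       =
  cong (ℕtoℚ 1 *_) (sym (trans (cong (λ m → Π 0 m (suc k)) (ℕₚ.+-identityʳ n)) (Π-zero n (suc k))))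
hyperW-closedForm k (suc r) zero    =
  trans (*-zeroʳ (ℕtoℚ (suc r !)))
        (sym (trans (cong (ℕtoℚ (1 ↑ suc r) *_) (Π-diagonal (suc r) (suc k))) (*-zeroʳ (ℕtoℚ (1 ↑ suc r)))))
hyperW-closedForm k (suc r) (suc n) = begin
  ℕtoℚ (suc r !) * (hyperW K (suc r) n + hyperW K r (suc n))
    ≡⟨ *-distribˡ-+ (ℕtoℚ (suc r !)) (hyperW K (suc r) n) (hyperW K r (suc n)) ⟩
  ℕtoℚ (suc r !) * hyperW K (suc r) n + ℕtoℚ (suc r !) * hyperW K r (suc n)
    ≡⟨ cong (ℕtoℚ (suc r !) * hyperW K (suc r) n +_) factorial-suc ⟩
  ℕtoℚ (suc r !) * hyperW K (suc r) n + s * (ℕtoℚ (r !) * hyperW K r (suc n))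
    ≡⟨ cong₂ (λ u v → u + s * v) (hyperW-closedForm k (suc r) n) (hyperW-closedForm k r (suc n)) ⟩
  P * X K + s * (Q * Π r (suc (n ℕ.+ r)) K)
    ≡⟨ cong (λ m → P * X K + s * (Q * Π r m K)) (ℕₚ.+-suc n r) ⟨
  P * X K + s * (Q * Π r M K)
    ≡⟨ cong (λ e → P * X K + s * (Q * e)) (Π-sucˡ r M K) ⟩
  P * X K + s * (Q * (X K + c * X k))
    ≡⟨ pascal-combination P Q P′ s c d (X K) (X k) pascal (inv^1-inverseʳ r) P′d≡Q ⟩
  P′ * (X K + d * X k)
    ≡⟨ cong (P′ *_) (Π-sucʳ (suc r) M K) ⟨
  P′ * Π (suc r) (suc M) K
    ∎
  where
  open ≡-Reasoning
  K  = suc k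
  M  = n ℕ.+ suc r
  X  = Π (suc r) M
  s  = ℕtoℚ (suc r)
  c  = inv^ (suc r) 1
  d  = inv^ (suc M) 1
  P  = ℕtoℚ (suc n ↑ suc r)
  Q  = ℕtoℚ (suc (suc n) ↑ r)
  P′ = ℕtoℚ (suc (suc n) ↑ suc r)

  factorial-suc : ℕtoℚ (suc r !) * hyperW K r (suc n) ≡ s * (ℕtoℚ (r !) * hyperW K r (suc n))
  factorial-suc = trans (cong (_* hyperW K r (suc n)) (ℕtoℚ-homo-* (suc r) (r !))) (*-assoc s (ℕtoℚ (r !)) (hyperW K r (suc n)))

  pascal : P + s * Q ≡ P′
  pascal = trans (cong (P +_) (sym (ℕtoℚ-homo-* (suc r) (suc (suc n) ↑ r))))
                 (trans (sym (ℕtoℚ-homo-+ (suc n ↑ suc r) (suc r ℕ.* (suc (suc n) ↑ r)))) (cong ℕtoℚ (↑-pascal (suc n) r)))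

  P′d≡Q : P′ * d ≡ Q
  P′d≡Q = trans (cong (λ e → ℕtoℚ (suc (suc n) ↑ r ℕ.* suc e) * d) (sym (ℕₚ.+-suc n r)))
                (*-inv^1-cancelʳ (suc (suc n) ↑ r) M)

invFactorial : ℕ → ℚ
invFactorial r = (ℤ.+ 1 / r !) {{r !≢0}}

rhsSummand : ℕ → ℕ → ℕ → ℕ → ℚ
rhsSummand K r p n = invFactorial r * sumFrom1 (suc r) (λ l → ℕtoℚ (stirling1 (suc r) l) * (Π r (n ℕ.+ r) K * inv^ n (p ℕ.+ 1 ∸ l)))

RHSpartial-as-sumFrom1 : ∀ K r p N → RHSpartial K r p N ≡ sumFrom1 N (rhsSummand K r p)
RHSpartial-as-sumFrom1 K r p N = begin
  invFactorial r * sumFrom1 (suc r) (λ l → st l * sumFrom0 K (λ i → ζ⋆₁± r i * Upartial (K ∸ i) r (q l) N))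
    ≡⟨ cong (invFactorial r *_) (sumFrom1-cong (suc r) (λ l _ →
         cong (st (suc l) *_) (sumFrom0-⊛ K N (ζ⋆₁± r) (λ n → ζ₁ (n ℕ.+ r)) (λ n → inv^ n (q (suc l)))))) ⟩
  invFactorial r * sumFrom1 (suc r) (λ l → st l * sumFrom1 N (λ n → term n l))
    ≡⟨ cong (invFactorial r *_) (sumFrom1-cong (suc r) (λ l _ → sumFrom1-*ˡ N (st (suc l)) (λ n → term n (suc l)))) ⟩
  invFactorial r * sumFrom1 (suc r) (λ l → sumFrom1 N (λ n → st l * term n l))
    ≡⟨ cong (invFactorial r *_) (sumFrom1-interchange (sumFrom1 (suc r)) (sumFrom1-zero (suc r)) (sumFrom1-+ (suc r)) N (λ l n → st l * term n l)) ⟩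
  invFactorial r * sumFrom1 N (λ n → sumFrom1 (suc r) (λ l → st l * term n l))
    ≡⟨ sumFrom1-*ˡ N (invFactorial r) (λ n → sumFrom1 (suc r) (λ l → st l * term n l)) ⟩
  sumFrom1 N (rhsSummand K r p)
    ∎
  where
  open ≡-Reasoning
  st : ℕ → ℚ
  st l = ℕtoℚ (stirling1 (suc r) l)
  q : ℕ → ℕ
  q l = p ℕ.+ 1 ∸ l
  term : ℕ → ℕ → ℚ
  term n l = Π r (n ℕ.+ r) K * inv^ n (q l)

hyperW-summand : ∀ k r p a → r ℕ.≤ p → hyperW (suc k) r (suc a) * inv^ (suc a) p ≡ rhsSummand (suc k) r p (suc a)
hyperW-summand k r p a r≤p = begin
  H * w                                                   ≡⟨ *-identityˡ (H * w) ⟨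
  1ℚ * (H * w)                                            ≡⟨ cong (_* (H * w)) (1/n*n≡1 (r !) {{r !≢0}}) ⟨
  invFactorial r * ℕtoℚ (r !) * (H * w)                   ≡⟨ regroup (invFactorial r) (ℕtoℚ (r !)) H w ⟩
  invFactorial r * (ℕtoℚ (r !) * H * w)                   ≡⟨ cong (λ e → invFactorial r * (e * w)) (hyperW-closedForm k r A) ⟩
  invFactorial r * (ℕtoℚ (suc A ↑ r) * E * w)             ≡⟨ cong (λ e → invFactorial r * (e * E * w)) (stirlingSum≡↑ r A) ⟨
  invFactorial r * (stirlingSum (suc r) A * E * w)
    ≡⟨ cong (invFactorial r *_) (trans (*-assoc (stirlingSum (suc r) A) E w) (sumFrom1-*ʳ (suc r) (E * w) (stirlingTerm (suc r) A))) ⟩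
  invFactorial r * sumFrom1 (suc r) (λ l → stirlingTerm (suc r) A l * (E * w))
    ≡⟨ cong (invFactorial r *_) (sumFrom1-cong (suc r) (λ l l<1+r → lower-power l (ℕₚ.≤-trans (ℕₚ.≤-pred l<1+r) r≤p))) ⟩
  rhsSummand (suc k) r p A
    ∎
  where
  open ≡-Reasoning
  A = suc a
  H = hyperW (suc k) r A
  w = inv^ A p
  E = Π r (A ℕ.+ r) (suc k)

  regroup : ∀ x y z v → x * y * (z * v) ≡ x * (y * z * v)
  regroup = solve-∀ ℚ-ring

  lower-power : ∀ l → l ℕ.≤ p → stirlingTerm (suc r) A (suc l) * (E * w) ≡ ℕtoℚ (stirling1 (suc r) (suc l)) * (E * inv^ A (p ℕ.+ 1 ∸ suc l))
  lower-power l l≤p = begin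
    s * ℕtoℚ (A ^ l) * (E * w)        ≡⟨ rotate s (ℕtoℚ (A ^ l)) E w ⟩
    s * (E * (ℕtoℚ (A ^ l) * w))      ≡⟨ cong (λ e → s * (E * e)) (inv^-∸ a l≤p) ⟨
    s * (E * inv^ A (p ∸ l))          ≡⟨ cong (λ e → s * (E * inv^ A (e ∸ suc l))) (ℕₚ.+-comm 1 p) ⟩
    s * (E * inv^ A (p ℕ.+ 1 ∸ suc l)) ∎
    where
    s = ℕtoℚ (stirling1 (suc r) (suc l))
    rotate : ∀ x y z v → x * y * (z * v) ≡ x * (z * (y * v))
    rotate = solve-∀ ℚ-ring

Spartial≡RHSpartial : ∀ k r p N → r ℕ.≤ p → Spartial (suc k) (suc r) p N ≡ RHSpartial (suc k) r p N
Spartial≡RHSpartial k r p N r≤p =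
  trans (sumFrom1-cong N (λ a _ → hyperW-summand k r p a r≤p)) (sym (RHSpartial-as-sumFrom1 (suc k) r p N))

theorem1p1 : (k : ℕ) → k ≥ 1 → (r p : ℕ) → p ≥ r ℕ.+ 2 →
    (ε : ℚ) → 0ℚ < ε → ∃ λ N₀ → (N : ℕ) → N ≥ N₀ →
      ∣ Spartial k (suc r) p N - RHSpartial k r p N ∣ < ε
theorem1p1 zero    ()
theorem1p1 (suc k) _  r p p≥r+2 ε 0<ε = 0 , λ N _ → subst (λ x → ∣ x ∣ < ε) (sym (difference≡0 N)) 0<ε
  where
  difference≡0 : ∀ N → Spartial (suc k) (suc r) p N - RHSpartial (suc k) r p N ≡ 0ℚ
  difference≡0 N = trans (cong (_- RHSpartial (suc k) r p N) (Spartial≡RHSpartial k r p N (ℕₚ.≤-trans (ℕₚ.m≤m+n r 2) p≥r+2)))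
                         (+-inverseʳ (RHSpartial (suc k) r p N))
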